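{- Let $u$ and $v$ be two distinct vertices of a graph $G$, and let $G'$ be the graph obtained from $G$ by removing $u$ and $v$. Suppose that the multiset of $G'$-degrees of the vertices of $G'$ adjacent to $u$ whose $G'$-degrees are at most $m-1$ and the multiset of $G'$-degrees of the vertices of $G'$ adjacent to $v$ whose $G'$-degrees are at most $m-1$ differ in at least $k+2$ elements (their multiset symmetric difference has size at least $k+2$). Then $u$ and $v$ have $(m,k)$-disjoint degree neighborhoods in $G$.
   Context: For a vertex $x$ of $G$, $D_x$ is the multiset of the $G$-degrees of the neighbors of $x$ whose $G$-degrees are at most $m$. Distinct vertices $u,v$ have $(m,k)$-disjoint degree neighborhoods if $|D_u\oplus D_v|\ge k$, where for multisets $A,B$, $|A\oplus B|=\sum_y|\mathrm{mult}_A(y)-\mathrm{mult}_B(y)|$. -}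

module Defs where

open import Data.Nat using (ℕ; suc; _≤_; _≤ᵇ_; ∣_-_∣; _⊔_)
open import Data.Bool using (Bool; true; false; _∧_; not; if_then_else_)
open import Data.Fin using (Fin; _≟_)
open import Data.List using (List; []; _∷_; map; upTo; foldr; _++_; allFin)
open import Data.Nat.ListAction using (sum)
open import Data.Product using (_×_)
import Data.Nat as ℕ
open import Relation.Nullary.Decidable using (⌊_⌋)
open import Relation.Binary.PropositionalEquality using (_≡_)
open import Data.Empty using (⊥)

record Graph (n : ℕ) : Set where
  field
    Adj   : Fin n → Fin n → Bool
    sym   : ∀ x y → Adj x y ≡ Adj y x
    loopless : ∀ x → Adj x x ≡ false
open Graph public

countB : {A : Set} → (A → Bool) → List A → ℕ
countB p [] = 0
countB p (x ∷ xs) = if p x then suc (countB p xs) else countB p xs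

degIn : ∀ {n} → Graph n → (Fin n → Bool) → Fin n → ℕ
degIn G S w = countB (λ z → S z ∧ Adj G w z) (allFin _)

univ : ∀ {n} → Fin n → Bool
univ _ = true

deg : ∀ {n} → Graph n → Fin n → ℕ
deg G = degIn G univ

minus2 : ∀ {n} → Fin n → Fin n → Fin n → Bool
minus2 u v w = not ⌊ w ≟ u ⌋ ∧ not ⌊ w ≟ v ⌋

degNbhdIn : ∀ {n} → Graph n → (Fin n → Bool) → ℕ → Fin n → List ℕ
degNbhdIn G S m x =
  foldr (λ w acc → if (S w ∧ Adj G x w ∧ (degIn G S w ≤ᵇ m))
                     then degIn G S w ∷ acc else acc) [] (allFin _)

D : ∀ {n} → Graph n → ℕ → Fin n → List ℕ
D G m x = degNbhdIn G univ m x

mult : List ℕ → ℕ → ℕ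
mult A y = countB (λ z → ⌊ z ℕ.≟ y ⌋) A

-- |A ⊕ B| = Σ_y |mult_A y - mult_B y|; all y outside 0..max(A++B) have
-- multiplicity 0 in both, so the sum ranges over y < 1 + max.
symDiffSize : List ℕ → List ℕ → ℕ
symDiffSize A B =
  sum (map (λ y → ∣ mult A y - mult B y ∣) (upTo (suc (foldr _⊔_ 0 (A ++ B)))))

DisjointDegNbhd : ∀ {n} → Graph n → ℕ → ℕ → Fin n → Fin n → Set
DisjointDegNbhd G m k u v = (u ≡ v → ⊥) × k ≤ symDiffSize (D G m u) (D G m v)

-- Write D′ₓ for the truncated degree multiset of x in G′ = G − u − v (bound m − 1) and Dₓ for
-- the one in G (bound m).  Every w ∈ G′ has deg_G w = deg_G′ w + [w ~ u] + [w ~ v], so a common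
-- neighbour of u and v shifts by 2 in both lists while a private neighbour of u (or v) shifts by
-- exactly 1 in its own list.  Hence, for every y, the counts of y in D′ᵤ and D′ᵥ differ by
-- exactly as much as the counts of y + 1 in Dᵤ and Dᵥ restricted to G′.  Dᵤ and Dᵥ differ from
-- these restrictions only by the entries coming from the edge uv, which lie at one value each;
-- summing over y therefore loses at most 2.
module Submission where

open import Defs hiding (sym)
open import Data.Nat using (ℕ; zero; suc; _≤_; _<_; _+_; _∸_; z≤n; s≤s; _≤ᵇ_; _⊔_; ∣_-_∣)
open import Data.Nat.Properties
open import Algebra.Properties.CommutativeSemigroup +-commutativeSemigroup
  using (interchange; x∙yz≈y∙xz; xy∙z≈xz∙y; xy∙z≈yz∙x)
open import Data.Bool using (Bool; true; false; _∧_; not; if_then_else_)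
open import Data.Bool.Properties using (∧-assoc; ∧-zeroʳ)
open import Data.Fin using (Fin; zero; suc)
import Data.Fin.Properties as Fin
open import Data.List using (List; []; _∷_; _++_; foldr; map; applyUpTo; allFin; tabulate)
open import Data.List.Properties using (map-tabulate)
open import Data.Nat.ListAction using (sum)
open import Data.Product using (_,_)
open import Function using (_∘_; id)
open import Relation.Binary.Definitions using (DecidableEquality)
open import Relation.Binary.PropositionalEquality
  using (_≡_; _≢_; refl; sym; trans; cong; cong₂; module ≡-Reasoning)
open import Relation.Nullary using (¬_; yes; no)
open import Relation.Nullary.Decidable using (⌊_⌋)
open import Data.Empty using (⊥-elim)

private variable
  A B : Set
  n : ℕ

ind : Bool → ℕ
ind true  = 1
ind false = 0

ind≤1 : ∀ b → ind b ≤ 1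
ind≤1 true  = ≤-refl
ind≤1 false = z≤n

ind-∧-exchange : ∀ s {a b c d} → ind a + ind b ≡ ind c + ind d →
                 ind (s ∧ a) + ind (s ∧ b) ≡ ind (s ∧ c) + ind (s ∧ d)
ind-∧-exchange true  eq = eq
ind-∧-exchange false _  = refl

⌊≟⌋-injective : (_≟ᴬ_ : DecidableEquality A) (_≟ᴮ_ : DecidableEquality B) (f : A → B) →
                (∀ {x y} → f x ≡ f y → x ≡ y) → ∀ x y → ⌊ f x ≟ᴮ f y ⌋ ≡ ⌊ x ≟ᴬ y ⌋
⌊≟⌋-injective _≟ᴬ_ _≟ᴮ_ f f-inj x y with x ≟ᴬ y | f x ≟ᴮ f y
... | yes _   | yes _     = refl
... | no  _   | no  _     = refl
... | yes x≡y | no  fx≢fy = ⊥-elim (fx≢fy (cong f x≡y))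
... | no  x≢y | yes fx≡fy = ⊥-elim (x≢y (f-inj fx≡fy))

countB-∷ : ∀ (p : A → Bool) x xs → countB p (x ∷ xs) ≡ ind (p x) + countB p xs
countB-∷ p x xs with p x
... | true  = refl
... | false = refl

countB-const-false : ∀ (xs : List A) → countB (λ _ → false) xs ≡ 0
countB-const-false []       = refl
countB-const-false (_ ∷ xs) = countB-const-false xs

countB-cong : ∀ {p q : A → Bool} → (∀ x → p x ≡ q x) → ∀ xs → countB p xs ≡ countB q xs
countB-cong eq [] = refl
countB-cong {p = p} {q} eq (x ∷ xs) = begin
  countB p (x ∷ xs)        ≡⟨ countB-∷ p x xs ⟩
  ind (p x) + countB p xs  ≡⟨ cong₂ _+_ (cong ind (eq x)) (countB-cong eq xs) ⟩
  ind (q x) + countB q xs  ≡⟨ countB-∷ q x xs ⟨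
  countB q (x ∷ xs)        ∎
  where open ≡-Reasoning

countB-++ : ∀ (p : A → Bool) xs ys → countB p (xs ++ ys) ≡ countB p xs + countB p ys
countB-++ p []       ys = refl
countB-++ p (x ∷ xs) ys = begin
  countB p (x ∷ xs ++ ys)                  ≡⟨ countB-∷ p x (xs ++ ys) ⟩
  ind (p x) + countB p (xs ++ ys)          ≡⟨ cong (ind (p x) +_) (countB-++ p xs ys) ⟩
  ind (p x) + (countB p xs + countB p ys)  ≡⟨ +-assoc (ind (p x)) _ _ ⟨
  ind (p x) + countB p xs + countB p ys    ≡⟨ cong (_+ countB p ys) (countB-∷ p x xs) ⟨
  countB p (x ∷ xs) + countB p ys          ∎
  where open ≡-Reasoning

countB-map : ∀ (p : B → Bool) (f : A → B) xs → countB p (map f xs) ≡ countB (p ∘ f) xs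
countB-map p f []       = refl
countB-map p f (x ∷ xs) with p (f x)
... | true  = cong suc (countB-map p f xs)
... | false = countB-map p f xs

countB-+-cong : ∀ {p q r s : A → Bool} →
                (∀ x → ind (p x) + ind (q x) ≡ ind (r x) + ind (s x)) →
                ∀ xs → countB p xs + countB q xs ≡ countB r xs + countB s xs
countB-+-cong eq [] = refl
countB-+-cong {p = p} {q} {r} {s} eq (x ∷ xs) = begin
  countB p (x ∷ xs) + countB q (x ∷ xs)
    ≡⟨ cong₂ _+_ (countB-∷ p x xs) (countB-∷ q x xs) ⟩
  (ind (p x) + countB p xs) + (ind (q x) + countB q xs)
    ≡⟨ interchange (ind (p x)) (countB p xs) (ind (q x)) (countB q xs) ⟩
  (ind (p x) + ind (q x)) + (countB p xs + countB q xs)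
    ≡⟨ cong₂ _+_ (eq x) (countB-+-cong eq xs) ⟩
  (ind (r x) + ind (s x)) + (countB r xs + countB s xs)
    ≡⟨ interchange (ind (r x)) (ind (s x)) (countB r xs) (countB s xs) ⟩
  (ind (r x) + countB r xs) + (ind (s x) + countB s xs)
    ≡⟨ cong₂ _+_ (countB-∷ r x xs) (countB-∷ s x xs) ⟨
  countB r (x ∷ xs) + countB s (x ∷ xs)
    ∎
  where open ≡-Reasoning

countB-split : ∀ (c p : A → Bool) xs →
               countB p xs ≡ countB (λ x → not (c x) ∧ p x) xs + countB (λ x → c x ∧ p x) xs
countB-split c p xs = begin
  countB p xs                            ≡⟨ +-identityʳ _ ⟨
  countB p xs + 0                        ≡⟨ cong (countB p xs +_) (countB-const-false xs) ⟨
  countB p xs + countB (λ _ → false) xs  ≡⟨ countB-+-cong (λ x → split (c x) (p x)) xs ⟩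
  countB (λ x → not (c x) ∧ p x) xs + countB (λ x → c x ∧ p x) xs ∎
  where
  open ≡-Reasoning
  split : ∀ a b → ind b + 0 ≡ ind (not a ∧ b) + ind (a ∧ b)
  split true  b = +-identityʳ (ind b)
  split false b = refl

countB-allFin-suc : ∀ (p : Fin (suc n) → Bool) →
                    countB p (allFin (suc n)) ≡ ind (p zero) + countB (p ∘ suc) (allFin n)
countB-allFin-suc {n} p = begin
  countB p (allFin (suc n))
    ≡⟨ countB-∷ p zero (tabulate suc) ⟩
  ind (p zero) + countB p (tabulate suc)
    ≡⟨ cong (λ xs → ind (p zero) + countB p xs) (map-tabulate id suc) ⟨
  ind (p zero) + countB p (map suc (allFin n))
    ≡⟨ cong (ind (p zero) +_) (countB-map p suc (allFin n)) ⟩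
  ind (p zero) + countB (p ∘ suc) (allFin n)
    ∎
  where open ≡-Reasoning

countB-allFin-≟ : ∀ (q : Fin n → Bool) x →
                  countB (λ w → ⌊ w Fin.≟ x ⌋ ∧ q w) (allFin n) ≡ ind (q x)
countB-allFin-≟ {suc n} q zero = begin
  countB (λ w → ⌊ w Fin.≟ zero ⌋ ∧ q w) (allFin (suc n))
    ≡⟨ countB-allFin-suc (λ w → ⌊ w Fin.≟ zero ⌋ ∧ q w) ⟩
  ind (q zero) + countB (λ _ → false) (allFin n)
    ≡⟨ cong (ind (q zero) +_) (countB-const-false (allFin n)) ⟩
  ind (q zero) + 0
    ≡⟨ +-identityʳ _ ⟩
  ind (q zero)
    ∎
  where open ≡-Reasoning
countB-allFin-≟ {suc n} q (suc x) = begin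
  countB (λ w → ⌊ w Fin.≟ suc x ⌋ ∧ q w) (allFin (suc n))
    ≡⟨ countB-allFin-suc (λ w → ⌊ w Fin.≟ suc x ⌋ ∧ q w) ⟩
  countB (λ w → ⌊ suc w Fin.≟ suc x ⌋ ∧ q (suc w)) (allFin n)
    ≡⟨ countB-cong (λ w → cong (_∧ q (suc w)) (⌊suc≟suc⌋ w)) (allFin n) ⟩
  countB (λ w → ⌊ w Fin.≟ x ⌋ ∧ q (suc w)) (allFin n)
    ≡⟨ countB-allFin-≟ (q ∘ suc) x ⟩
  ind (q (suc x))
    ∎
  where
  open ≡-Reasoning
  ⌊suc≟suc⌋ : ∀ w → ⌊ suc w Fin.≟ suc x ⌋ ≡ ⌊ w Fin.≟ x ⌋
  ⌊suc≟suc⌋ w = ⌊≟⌋-injective Fin._≟_ Fin._≟_ suc Fin.suc-injective w x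

mult-++ : ∀ xs ys y → mult (xs ++ ys) y ≡ mult xs y + mult ys y
mult-++ xs ys y = countB-++ _ xs ys

mult-beyond-max : ∀ xs y → foldr _⊔_ 0 xs < y → mult xs y ≡ 0
mult-beyond-max []       y _ = refl
mult-beyond-max (x ∷ xs) y max<y with x ≟ y
... | yes refl = ⊥-elim (<-irrefl refl (m⊔n<o⇒m<o x _ max<y))
... | no  _    = mult-beyond-max xs y (m⊔n<o⇒n<o x _ max<y)

mult-foldr-select : ∀ (c : A → Bool) (f : A → ℕ) xs y →
  mult (foldr (λ a acc → if c a then f a ∷ acc else acc) [] xs) y ≡ countB (λ a → c a ∧ ⌊ f a ≟ y ⌋) xs
mult-foldr-select c f []       y = refl
mult-foldr-select c f (x ∷ xs) y with c x
... | false = mult-foldr-select c f xs y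
... | true with ⌊ f x ≟ y ⌋
...   | true  = cong suc (mult-foldr-select c f xs y)
...   | false = mult-foldr-select c f xs y

sumTo : ℕ → (ℕ → ℕ) → ℕ
sumTo zero    f = 0
sumTo (suc N) f = f 0 + sumTo N (f ∘ suc)

sum-map-applyUpTo : ∀ (g f : ℕ → ℕ) N → sum (map g (applyUpTo f N)) ≡ sumTo N (g ∘ f)
sum-map-applyUpTo g f zero    = refl
sum-map-applyUpTo g f (suc N) = cong (g (f 0) +_) (sum-map-applyUpTo g (f ∘ suc) N)

sumTo-mono-≤ : ∀ {f g} N → (∀ y → f y ≤ g y) → sumTo N f ≤ sumTo N g
sumTo-mono-≤ zero    f≤g = z≤n
sumTo-mono-≤ (suc N) f≤g = +-mono-≤ (f≤g 0) (sumTo-mono-≤ N (f≤g ∘ suc))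

sumTo-+ : ∀ N (f g : ℕ → ℕ) → sumTo N (λ y → f y + g y) ≡ sumTo N f + sumTo N g
sumTo-+ zero    f g = refl
sumTo-+ (suc N) f g = trans (cong (f 0 + g 0 +_) (sumTo-+ N (f ∘ suc) (g ∘ suc)))
                            (interchange (f 0) (g 0) (sumTo N (f ∘ suc)) (sumTo N (g ∘ suc)))

sumTo-∘suc-≤ : ∀ N f → sumTo N (f ∘ suc) ≤ sumTo (suc N) f
sumTo-∘suc-≤ N f = m≤n+m (sumTo N (f ∘ suc)) (f 0)

sumTo-≤-support : ∀ {f} M → (∀ y → M ≤ y → f y ≡ 0) → ∀ K → sumTo K f ≤ sumTo M f
sumTo-≤-support zero    vanish zero    = z≤n
sumTo-≤-support zero    vanish (suc K) rewrite vanish 0 z≤n =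
  sumTo-≤-support zero (λ y _ → vanish (suc y) z≤n) K
sumTo-≤-support (suc M) vanish zero    = z≤n
sumTo-≤-support {f} (suc M) vanish (suc K) =
  +-monoʳ-≤ (f 0) (sumTo-≤-support M (λ y M≤y → vanish (suc y) (s≤s M≤y)) K)

sumTo-≤-point : ∀ {f} c → (∀ y → y ≢ c → f y ≡ 0) → ∀ N → sumTo N f ≤ f c
sumTo-≤-point c       vanish zero = z≤n
sumTo-≤-point {f} zero vanish (suc N) = begin
  f 0 + sumTo N (f ∘ suc)  ≤⟨ +-monoʳ-≤ (f 0) (sumTo-≤-support 0 (λ y _ → vanish (suc y) λ ()) N) ⟩
  f 0 + 0                  ≡⟨ +-identityʳ (f 0) ⟩
  f 0                      ∎
  where open ≤-Reasoning
sumTo-≤-point (suc c) vanish (suc N) rewrite vanish 0 (λ ()) =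
  sumTo-≤-point c (λ y y≢c → vanish (suc y) (y≢c ∘ suc-injective)) N

symDiffSize-sumTo : ∀ xs ys →
  symDiffSize xs ys ≡ sumTo (suc (foldr _⊔_ 0 (xs ++ ys))) (λ y → ∣ mult xs y - mult ys y ∣)
symDiffSize-sumTo xs ys =
  sum-map-applyUpTo (λ y → ∣ mult xs y - mult ys y ∣) id (suc (foldr _⊔_ 0 (xs ++ ys)))

sumTo-≤-symDiffSize : ∀ xs ys K → sumTo K (λ y → ∣ mult xs y - mult ys y ∣) ≤ symDiffSize xs ys
sumTo-≤-symDiffSize xs ys K rewrite symDiffSize-sumTo xs ys = sumTo-≤-support _ vanish K
  where
  vanish : ∀ y → suc (foldr _⊔_ 0 (xs ++ ys)) ≤ y → ∣ mult xs y - mult ys y ∣ ≡ 0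
  vanish y max<y = cong₂ ∣_-_∣ (m+n≡0⇒m≡0 (mult xs y) both≡0) (m+n≡0⇒n≡0 (mult xs y) both≡0)
    where
    both≡0 : mult xs y + mult ys y ≡ 0
    both≡0 = trans (sym (mult-++ xs ys y)) (mult-beyond-max (xs ++ ys) y max<y)

∣-∣-balance : ∀ a b α β → a + β ≡ α + b → ∣ a - b ∣ ≡ ∣ α - β ∣
∣-∣-balance a b α β eq = begin
  ∣ a - b ∣              ≡⟨ ∣m+n-m+o∣≡∣n-o∣ β a b ⟨
  ∣ β + a - β + b ∣      ≡⟨ cong₂ ∣_-_∣ (trans (+-comm β a) eq) (+-comm β b) ⟩
  ∣ α + b - b + β ∣      ≡⟨ cong (∣_- b + β ∣) (+-comm α b) ⟩
  ∣ b + α - b + β ∣      ≡⟨ ∣m+n-m+o∣≡∣n-o∣ b α β ⟩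
  ∣ α - β ∣              ∎
  where open ≡-Reasoning

∣-∣-≤-shift : ∀ α β c d → ∣ α - β ∣ ≤ ∣ α + c - β + d ∣ + (c + d)
∣-∣-≤-shift α β c d = begin
  ∣ α - β ∣                                         ≤⟨ ∣-∣-triangle α (α + c) β ⟩
  ∣ α - α + c ∣ + ∣ α + c - β ∣
    ≤⟨ +-monoʳ-≤ ∣ α - α + c ∣ (∣-∣-triangle (α + c) (β + d) β) ⟩
  ∣ α - α + c ∣ + (X + ∣ β + d - β ∣)               ≡⟨ cong₂ (λ s t → s + (X + t)) (∣m-m+n∣≡n α c)
                                                             (trans (∣-∣-comm (β + d) β) (∣m-m+n∣≡n β d)) ⟩
  c + (X + d)                                       ≡⟨ x∙yz≈y∙xz c X d ⟩
  X + (c + d)                                       ∎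
  where
  open ≤-Reasoning
  X = ∣ α + c - β + d ∣

countIn : (Fin n → Bool) → (Fin n → Bool) → ℕ
countIn S p = countB (λ w → S w ∧ p w) (allFin _)

_∖_ : (Fin n → Bool) → Fin n → Fin n → Bool
(S ∖ x) w = S w ∧ not ⌊ w Fin.≟ x ⌋

countIn-∖ : ∀ (S p : Fin n → Bool) x → countIn S p ≡ countIn (S ∖ x) p + ind (S x ∧ p x)
countIn-∖ S p x = begin
  countIn S p
    ≡⟨ countB-split (λ w → ⌊ w Fin.≟ x ⌋) (λ w → S w ∧ p w) (allFin _) ⟩
  countB (λ w → not ⌊ w Fin.≟ x ⌋ ∧ (S w ∧ p w)) (allFin _)
    + countB (λ w → ⌊ w Fin.≟ x ⌋ ∧ (S w ∧ p w)) (allFin _)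
    ≡⟨ cong₂ _+_ (countB-cong (λ w → reorder (S w) _ (p w)) (allFin _)) (countB-allFin-≟ (λ w → S w ∧ p w) x) ⟩
  countIn (S ∖ x) p + ind (S x ∧ p x)
    ∎
  where
  open ≡-Reasoning
  reorder : ∀ s c b → c ∧ (s ∧ b) ≡ (s ∧ c) ∧ b
  reorder true  c b = refl
  reorder false c b = ∧-zeroʳ c

-- minus2 u v is, definitionally, (univ ∖ u) ∖ v.
countIn-minus2 : ∀ {u v : Fin n} → u ≢ v → ∀ p →
                 countIn univ p ≡ countIn (minus2 u v) p + ind (p u) + ind (p v)
countIn-minus2 {u = u} {v} u≢v p = begin
  countIn univ p                                                   ≡⟨ countIn-∖ univ p u ⟩
  countIn (univ ∖ u) p + ind (p u)                                 ≡⟨ cong (_+ ind (p u)) (countIn-∖ (univ ∖ u) p v) ⟩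
  countIn (minus2 u v) p + ind (not ⌊ v Fin.≟ u ⌋ ∧ p v) + ind (p u)
    ≡⟨ cong (λ b → countIn (minus2 u v) p + ind (not b ∧ p v) + ind (p u)) v≟u≡false ⟩
  countIn (minus2 u v) p + ind (p v) + ind (p u)                   ≡⟨ xy∙z≈xz∙y _ (ind (p v)) (ind (p u)) ⟩
  countIn (minus2 u v) p + ind (p u) + ind (p v)                   ∎
  where
  open ≡-Reasoning
  v≟u≡false : ⌊ v Fin.≟ u ⌋ ≡ false
  v≟u≡false with v Fin.≟ u
  ... | yes v≡u = ⊥-elim (u≢v (sym v≡u))
  ... | no  _   = refl

deg-minus2 : ∀ (G : Graph n) {u v} → u ≢ v → ∀ w →
             deg G w ≡ ind (Adj G u w) + ind (Adj G v w) + degIn G (minus2 u v) w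
deg-minus2 G {u} {v} u≢v w = begin
  deg G w                                                          ≡⟨ countIn-minus2 u≢v (Adj G w) ⟩
  degIn G (minus2 u v) w + ind (Adj G w u) + ind (Adj G w v)       ≡⟨ xy∙z≈yz∙x (degIn G (minus2 u v) w) _ _ ⟩
  ind (Adj G w u) + ind (Adj G w v) + degIn G (minus2 u v) w
    ≡⟨ cong₂ (λ a b → ind a + ind b + degIn G (minus2 u v) w) (Graph.sym G w u) (Graph.sym G w v) ⟩
  ind (Adj G u w) + ind (Adj G v w) + degIn G (minus2 u v) w       ∎
  where open ≡-Reasoning

recordedAt : ℕ → ℕ → ℕ → Bool
recordedAt m y d = (d ≤ᵇ m) ∧ ⌊ d ≟ y ⌋

≤ᵇ-suc : ∀ d m → (suc d ≤ᵇ suc m) ≡ (d ≤ᵇ m)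
≤ᵇ-suc zero    m = refl
≤ᵇ-suc (suc d) m = refl

recordedAt-suc : ∀ m y d → recordedAt (suc m) (suc y) (suc d) ≡ recordedAt m y d
recordedAt-suc m y d = cong₂ _∧_ (≤ᵇ-suc d m) (⌊≟⌋-injective _≟_ _≟_ suc suc-injective d y)

mult-degNbhdIn : ∀ (G : Graph n) S m x y →
  mult (degNbhdIn G S m x) y ≡ countIn S (λ w → Adj G x w ∧ recordedAt m y (degIn G S w))
mult-degNbhdIn G S m x y =
  trans (mult-foldr-select (λ w → S w ∧ Adj G x w ∧ (degIn G S w ≤ᵇ m)) (degIn G S) (allFin _) y)
        (countB-cong (λ w → reassoc (S w) (Adj G x w) _ _) (allFin _))
  where
  reassoc : ∀ a b c d → (a ∧ b ∧ c) ∧ d ≡ a ∧ b ∧ c ∧ d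
  reassoc a b c d = trans (∧-assoc a (b ∧ c) d) (cong (a ∧_) (∧-assoc b c d))

-- Read a, b as adjacency of a vertex to u and v and d as its degree in G′, so that
-- ind a + ind b + d is its degree in G.
recordedAt-exchange : ∀ a b m y d →
  ind (a ∧ recordedAt m y d) + ind (b ∧ recordedAt (suc m) (suc y) (ind a + ind b + d))
  ≡ ind (a ∧ recordedAt (suc m) (suc y) (ind a + ind b + d)) + ind (b ∧ recordedAt m y d)
recordedAt-exchange false false m y d = refl
recordedAt-exchange true  true  m y d = +-comm (ind (recordedAt m y d)) _
recordedAt-exchange true  false m y d = cong (λ b → ind b + 0) (sym (recordedAt-suc m y d))
recordedAt-exchange false true  m y d = cong ind (recordedAt-suc m y d)

sumTo-recordedAt≤1 : ∀ a m d N → sumTo N (λ y → ind (a ∧ recordedAt m y d)) ≤ 1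
sumTo-recordedAt≤1 a m d N = ≤-trans (sumTo-≤-point d vanish N) (ind≤1 _)
  where
  vanish : ∀ y → y ≢ d → ind (a ∧ recordedAt m y d) ≡ 0
  vanish y y≢d with d ≟ y
  ... | yes d≡y = ⊥-elim (y≢d (sym d≡y))
  ... | no  _   = cong ind (trans (cong (a ∧_) (∧-zeroʳ (d ≤ᵇ m))) (∧-zeroʳ a))

module DeleteTwo (G : Graph n) (m : ℕ) {u v : Fin n} (u≢v : u ≢ v) where

  G′ : Fin n → Bool
  G′ = minus2 u v

  deg′ : Fin n → ℕ
  deg′ = degIn G G′

  -- w contributes the value y to Dₓ (inD, in G) resp. to D′ₓ (inD′, in G′).
  inD inD′ : Fin n → ℕ → Fin n → Bool
  inD  x y w = Adj G x w ∧ recordedAt (suc m) y (deg G w)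
  inD′ x y w = Adj G x w ∧ recordedAt m y (deg′ w)

  multD multD′ : Fin n → ℕ → ℕ
  multD  x y = mult (D G (suc m) x) y
  multD′ x y = mult (degNbhdIn G G′ m x) y

  multD-split : ∀ x y → multD x y ≡ countIn G′ (inD x y) + ind (inD x y u) + ind (inD x y v)
  multD-split x y = trans (mult-degNbhdIn G univ (suc m) x y) (countIn-minus2 u≢v (inD x y))

  no-loop : ∀ x y → ind (inD x y x) ≡ 0
  no-loop x y = cong (λ b → ind (b ∧ recordedAt (suc m) y (deg G x))) (loopless G x)

  multD-u : ∀ y → multD u y ≡ countIn G′ (inD u y) + ind (inD u y v)
  multD-u y = trans (multD-split u y)
                    (cong (_+ ind (inD u y v)) (trans (cong (countIn G′ (inD u y) +_) (no-loop u y)) (+-identityʳ _)))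

  multD-v : ∀ y → multD v y ≡ countIn G′ (inD v y) + ind (inD v y u)
  multD-v y = trans (multD-split v y)
                    (trans (cong (countIn G′ (inD v y) + ind (inD v y u) +_) (no-loop v y)) (+-identityʳ _))

  balance : ∀ y → multD′ u y + countIn G′ (inD v (suc y)) ≡ countIn G′ (inD u (suc y)) + multD′ v y
  balance y = begin
    multD′ u y + countIn G′ (inD v (suc y))
      ≡⟨ cong (_+ countIn G′ (inD v (suc y))) (mult-degNbhdIn G G′ m u y) ⟩
    countIn G′ (inD′ u y) + countIn G′ (inD v (suc y))     ≡⟨ countB-+-cong exchange (allFin n) ⟩
    countIn G′ (inD u (suc y)) + countIn G′ (inD′ v y)
      ≡⟨ cong (countIn G′ (inD u (suc y)) +_) (mult-degNbhdIn G G′ m v y) ⟨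
    countIn G′ (inD u (suc y)) + multD′ v y                ∎
    where
    open ≡-Reasoning
    exchange : ∀ w → ind (G′ w ∧ inD′ u y w) + ind (G′ w ∧ inD v (suc y) w)
                   ≡ ind (G′ w ∧ inD u (suc y) w) + ind (G′ w ∧ inD′ v y w)
    exchange w rewrite deg-minus2 G u≢v w =
      ind-∧-exchange (G′ w) (recordedAt-exchange (Adj G u w) (Adj G v w) m y (deg′ w))

  pointwise : ∀ y → ∣ multD′ u y - multD′ v y ∣
                    ≤ ∣ multD u (suc y) - multD v (suc y) ∣ + (ind (inD u (suc y) v) + ind (inD v (suc y) u))
  pointwise y = begin
    ∣ multD′ u y - multD′ v y ∣        ≡⟨ ∣-∣-balance (multD′ u y) (multD′ v y) α β (balance y) ⟩
    ∣ α - β ∣                          ≤⟨ ∣-∣-≤-shift α β eᵤ eᵥ ⟩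
    ∣ α + eᵤ - β + eᵥ ∣ + (eᵤ + eᵥ)
      ≡⟨ cong₂ (λ a b → ∣ a - b ∣ + (eᵤ + eᵥ)) (multD-u (suc y)) (multD-v (suc y)) ⟨
    ∣ multD u (suc y) - multD v (suc y) ∣ + (eᵤ + eᵥ) ∎
    where
    open ≤-Reasoning
    α = countIn G′ (inD u (suc y))
    β = countIn G′ (inD v (suc y))
    eᵤ = ind (inD u (suc y) v)
    eᵥ = ind (inD v (suc y) u)

  symDiffSize-≤ : symDiffSize (degNbhdIn G G′ m u) (degNbhdIn G G′ m v)
                  ≤ symDiffSize (D G (suc m) u) (D G (suc m) v) + 2
  symDiffSize-≤ = begin
    symDiffSize D′ᵤ D′ᵥ                         ≡⟨ symDiffSize-sumTo D′ᵤ D′ᵥ ⟩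
    sumTo N f                                  ≤⟨ sumTo-mono-≤ N pointwise ⟩
    sumTo N (λ y → g (suc y) + e (suc y))      ≡⟨ sumTo-+ N (g ∘ suc) (e ∘ suc) ⟩
    sumTo N (g ∘ suc) + sumTo N (e ∘ suc)      ≤⟨ +-mono-≤ (sumTo-∘suc-≤ N g) (sumTo-∘suc-≤ N e) ⟩
    sumTo (suc N) g + sumTo (suc N) e          ≤⟨ +-mono-≤ (sumTo-≤-symDiffSize Dᵤ Dᵥ (suc N)) edges≤2 ⟩
    symDiffSize Dᵤ Dᵥ + 2                       ∎
    where
    open ≤-Reasoning
    D′ᵤ D′ᵥ Dᵤ Dᵥ : List ℕ
    D′ᵤ = degNbhdIn G G′ m u
    D′ᵥ = degNbhdIn G G′ m v
    Dᵤ = D G (suc m) u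
    Dᵥ = D G (suc m) v
    N = suc (foldr _⊔_ 0 (D′ᵤ ++ D′ᵥ))
    f g eᵤ eᵥ e : ℕ → ℕ
    f y = ∣ multD′ u y - multD′ v y ∣
    g y = ∣ multD u y - multD v y ∣
    eᵤ y = ind (inD u y v)
    eᵥ y = ind (inD v y u)
    e y = eᵤ y + eᵥ y
    edges≤2 : sumTo (suc N) e ≤ 2
    edges≤2 = begin
      sumTo (suc N) e                          ≡⟨ sumTo-+ (suc N) eᵤ eᵥ ⟩
      sumTo (suc N) eᵤ + sumTo (suc N) eᵥ      ≤⟨ +-mono-≤ (sumTo-recordedAt≤1 (Adj G u v) (suc m) (deg G v) (suc N))
                                                           (sumTo-recordedAt≤1 (Adj G v u) (suc m) (deg G u) (suc N)) ⟩
      2                                        ∎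

lemma27 : ∀ {n} (G : Graph n) (m k : ℕ) (u v : Fin n) →
    1 ≤ m → ¬ (u ≡ v) →
    k + 2 ≤ symDiffSize (degNbhdIn G (minus2 u v) (m ∸ 1) u)
                        (degNbhdIn G (minus2 u v) (m ∸ 1) v) →
    DisjointDegNbhd G m k u v
lemma27 G zero    k u v () _ _
lemma27 G (suc m) k u v _ u≢v k+2≤ =
  u≢v , +-cancelʳ-≤ 2 k _ (≤-trans k+2≤ (DeleteTwo.symDiffSize-≤ G m u≢v))
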